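{- Let $H$ be a hypergraph with no isolated vertices, and let $p\in(0,1)$ be such that every edge in $H$ is flammable with respect to $p$. Then $$\min\{\lceil p|e|\rceil \mid e\in E(H)\}\leq b_{L,p}(H)< b_p(H)\leq 1+\sum_{e\in E(H)}\lceil p|e|\rceil.$$
   Context: A hypergraph $H=(V(H),E(H))$ has a finite nonempty vertex set and a finite collection $E(H)$ of subsets of $V(H)$ called edges (parallel edges allowed); a vertex is isolated if it lies in no edge. An edge $e$ is non-flammable with respect to $p$ if $\lceil p|e|\rceil=|e|$, and flammable otherwise. For a proportion $p\in(0,1)$, the proportion-based propagation rule is: if at the end of a round at least $\lceil p|e|\rceil$ vertices of an edge $e$ are on fire, then in the next round all vertices of $e$ catch fire; burned vertices stay burned. Burning game: let $F_0=\emptyset$ and $F_r$ be the set of burned vertices at the end of round $r$. In each round $r\geq 1$, simultaneously, vertices catch fire by propagation from $F_{r-1}$ (no propagation in round 1), and a player chooses a vertex $u_r\notin F_{r-1}$ (a source) and sets it on fire. A burning sequence is a sequence $(u_1,\ldots,u_k)$ of such sources after which every vertex is on fire at the end of round $k$; $b_p(H)$ is the minimum length of a burning sequence. Lazy game: $S\subseteq V(H)$ is a lazy burning set if, setting all of $S$ on fire at once and then repeatedly applying the propagation rule, every vertex eventually catches fire; $b_{L,p}(H)$ is the minimum size of a lazy burning set.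
   Formalization: The proportion p ranges only over rational numbers in (0,1). -}

module Defs where

open import Data.Nat as ℕ using (ℕ; zero; suc; _≤_; _<_; _≤?_; _⊓_)
open import Data.Integer as ℤ using (ℤ; ∣_∣)
open import Data.Rational as ℚ using (ℚ; ceiling; _/_)
open import Data.Fin using (Fin)
open import Data.Fin.Subset using (Subset; _∪_; _∩_; ⁅_⁆; _∈_; _∉_) renaming (⊥ to ∅; ⊤ to Full; ∣_∣ to size)
open import Data.List using (List; []; _∷_; foldr; map; length)
open import Data.Nat.ListAction using (sum)
open import Data.List.Relation.Unary.Any using (Any)
open import Data.List.Relation.Unary.All using (All)
open import Data.Product using (Σ; ∃; _×_)
open import Data.Bool using (if_then_else_)
open import Data.Unit using (⊤)
open import Relation.Nullary using (¬_)
open import Relation.Nullary.Decidable using (⌊_⌋)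
open import Relation.Binary.PropositionalEquality using (_≡_; _≢_)

-- A hypergraph on the nonempty vertex set Fin (suc m); edges form a list
-- (so parallel edges are allowed), each edge a subset of the vertex set.
record Hypergraph : Set where
  constructor hypergraph
  field
    m     : ℕ
    edges : List (Subset (suc m))
  V : ℕ
  V = suc m
open Hypergraph public

-- ⌈ p * k ⌉ as a natural number (p > 0 in all uses, so the ceiling is ≥ 0
-- and ∣_∣ just converts it to ℕ).
thr : ℚ → ℕ → ℕ
thr p k = ∣ ceiling (p ℚ.* (ℤ.+ k / 1)) ∣

Isolated : (H : Hypergraph) → Fin (V H) → Set
Isolated H v = All (λ e → v ∉ e) (edges H)

NoIsolated : Hypergraph → Set
NoIsolated H = (v : Fin (V H)) → ¬ Isolated H v

Flammable : ℚ → {n : ℕ} → Subset n → Set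
Flammable p e = thr p (size e) ≢ size e

AllFlammable : Hypergraph → ℚ → Set
AllFlammable H p = All (Flammable p) (edges H)

propagate : (H : Hypergraph) → ℚ → Subset (V H) → Subset (V H)
propagate H p F =
  foldr (λ e acc → if ⌊ thr p (size e) ≤? size (e ∩ F) ⌋ then e ∪ acc else acc)
        F (edges H)

play : (H : Hypergraph) → ℚ → Subset (V H) → List (Fin (V H)) → Subset (V H)
play H p F []       = F
play H p F (u ∷ us) = play H p (propagate H p F ∪ ⁅ u ⁆) us

legal : (H : Hypergraph) → ℚ → Subset (V H) → List (Fin (V H)) → Set
legal H p F []       = ⊤
legal H p F (u ∷ us) = (u ∉ F) × legal H p (propagate H p F ∪ ⁅ u ⁆) us

-- burned set at the end of the last round (F₀ = ∅; round 1: no propagation,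
-- so F₁ = ⁅ u₁ ⁆)
finalFire : (H : Hypergraph) → ℚ → List (Fin (V H)) → Subset (V H)
finalFire H p []       = ∅
finalFire H p (u ∷ us) = play H p ⁅ u ⁆ us

-- legality of the sources (u₁ ∉ F₀ = ∅ holds trivially)
Legal : (H : Hypergraph) → ℚ → List (Fin (V H)) → Set
Legal H p []       = ⊤
Legal H p (u ∷ us) = legal H p ⁅ u ⁆ us

IsBurningSequence : (H : Hypergraph) → ℚ → List (Fin (V H)) → Set
IsBurningSequence H p s = Legal H p s × finalFire H p s ≡ Full

IsBurningNumber : (H : Hypergraph) → ℚ → ℕ → Set
IsBurningNumber H p b =
  (Σ (List (Fin (V H))) λ s → IsBurningSequence H p s × length s ≡ b)
  × ((s : List (Fin (V H))) → IsBurningSequence H p s → b ≤ length s)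

iterate : {A : Set} → (A → A) → ℕ → A → A
iterate f zero    x = x
iterate f (suc k) x = f (iterate f k x)

IsLazyBurningSet : (H : Hypergraph) → ℚ → Subset (V H) → Set
IsLazyBurningSet H p S = ∃ λ k → iterate (propagate H p) k S ≡ Full

IsLazyBurningNumber : (H : Hypergraph) → ℚ → ℕ → Set
IsLazyBurningNumber H p b =
  (Σ (Subset (V H)) λ S → IsLazyBurningSet H p S × size S ≡ b)
  × ((S : Subset (V H)) → IsLazyBurningSet H p S → b ≤ size S)

-- min { ⌈ p |e| ⌉ | e ∈ E(H) }  (default 0 for an edgeless hypergraph,
-- which cannot occur under the theorem's hypotheses)
minThr : Hypergraph → ℚ → ℕ
minThr H p with edges H
... | []     = 0
... | e ∷ es = foldr (λ e' acc → thr p (size e') ⊓ acc) (thr p (size e)) es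

sumThr : Hypergraph → ℚ → ℕ
sumThr H p = sum (map (λ e → thr p (size e)) (edges H))

-- A set smaller than every threshold ⌈p|e|⌉ ignites no edge, so it is a fixed point of propagation
-- and cannot be a lazy burning set.  Given a burning sequence, the sources of all rounds but the last,
-- set on fire at once, burn within as many rounds everything the game burnt before its last round;
-- so after one more round at most the last source is unburnt, and since ⌈p|e|⌉ < |e| every edge then
-- fires: this lazy burning set is smaller than the sequence.  For the upper bound, play greedily an
-- unburnt vertex of an edge that does not fire yet: this lowers Σ_e (⌈p|e|⌉ ∸ |e ∩ F|), which starts
-- at Σ_e ⌈p|e|⌉, and once every edge fires one further source ends the game.

module Submission where

open import Data.Empty using (⊥-elim)
open import Data.Fin using (Fin; zero)
import Data.Fin.Properties as Finₚ
open import Data.Fin.Subset using (Subset; _∪_; _∩_; ⁅_⁆; _∈_; _∉_; _⊆_; ⋃; inside; outside)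
  renaming (⊥ to ∅; ⊤ to Full; ∣_∣ to size)
open import Data.Fin.Subset.Properties using (_∈?_)
import Data.Fin.Subset.Properties as Subsetₚ
open import Data.Integer as ℤ using (+_; +[1+_]; -[1+_]; ∣_∣)
import Data.Integer.DivMod as ℤ
import Data.Integer.Properties as ℤₚ
open import Data.Integer.Tactic.RingSolver using (solve-∀)
open import Data.List using (List; []; _∷_; _∷ʳ_; foldr; map; length; InitLast; initLast; _∷ʳ′_)
open import Data.List.Properties using (length-++)
open import Data.List.Membership.Propositional using (find; lose) renaming (_∈_ to _∈ₗ_)
open import Data.List.Relation.Unary.All as All using (All; []; _∷_)
open import Data.List.Relation.Unary.All.Properties using (¬All⇒Any¬)
open import Data.List.Relation.Unary.Any as Any using (Any; here; there)
open import Data.Nat as ℕ using (ℕ; zero; suc; _≤_; _<_; _≤?_; _+_; _∸_; _⊓_; z≤n; s≤s)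
open import Data.Nat.ListAction using (sum)
import Data.Nat.Properties as ℕₚ
open import Data.Nat.Coprimality using (1-coprimeTo) renaming (sym to coprime-sym)
open import Data.Product using (Σ; ∃; _×_; _,_; proj₂)
open import Data.Rational as ℚ using (ℚ; mkℚ; ceiling; _/_; 0ℚ; 1ℚ; ↥_; ↧_) renaming (_<_ to _<ℚ_)
import Data.Rational.Properties as ℚₚ
open import Data.Sum using (_⊎_; inj₁; inj₂; [_,_]′)
open import Data.Bool using (if_then_else_)
open import Data.Unit using (tt)
open import Data.Vec using ([]; _∷_)
open import Relation.Nullary using (¬_; Dec; yes; no; ¬?)
open import Relation.Nullary.Decidable using (⌊_⌋; _×-dec_; decidable-stable)
open import Relation.Binary.PropositionalEquality

open import Defs

neg-swap : ∀ a r x → ℤ.- a ≡ r ℤ.+ x → ℤ.- x ≡ a ℤ.+ r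
neg-swap a r x -a≡r+x = begin
  ℤ.- x                                    ≡⟨ regroup a r x ⟩
  a ℤ.+ r ℤ.+ (ℤ.- a ℤ.+ ℤ.- (r ℤ.+ x))    ≡⟨ cong (λ y → a ℤ.+ r ℤ.+ (y ℤ.+ ℤ.- (r ℤ.+ x))) -a≡r+x ⟩
  a ℤ.+ r ℤ.+ (r ℤ.+ x ℤ.+ ℤ.- (r ℤ.+ x))  ≡⟨ cong (λ y → a ℤ.+ r ℤ.+ y) (ℤₚ.+-inverseʳ (r ℤ.+ x)) ⟩
  a ℤ.+ r ℤ.+ + 0                          ≡⟨ ℤₚ.+-identityʳ (a ℤ.+ r) ⟩
  a ℤ.+ r                                  ∎
  where
  open ≡-Reasoning
  regroup : ∀ a r x → ℤ.- x ≡ a ℤ.+ r ℤ.+ (ℤ.- a ℤ.+ ℤ.- (r ℤ.+ x))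
  regroup = solve-∀

-- Splitting on the numerator lets the negation inside ceiling compute.
ceiling≡ : ∀ q → ceiling q ≡ ℤ.- ((ℤ.- ↥ q) ℤ./ ↧ q)
ceiling≡ (mkℚ (+ zero)   _ _) = refl
ceiling≡ (mkℚ +[1+ _ ]   _ _) = refl
ceiling≡ (mkℚ -[1+ _ ]   _ _) = refl

ceiling-lower : ∀ q → ↥ q ℤ.≤ ceiling q ℤ.* ↧ q
ceiling-lower q rewrite ceiling≡ q =
  subst₂ ℤ._≤_ (ℤₚ.neg-involutive (↥ q)) (ℤₚ.neg-distribˡ-* ((ℤ.- ↥ q) ℤ./ ↧ q) (↧ q))
    (ℤₚ.neg-mono-≤ (ℤ.[n/d]*d≤n (ℤ.- ↥ q) (↧ q)))

ceiling-upper : ∀ q → ceiling q ℤ.* ↧ q ℤ.< ↥ q ℤ.+ ↧ q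
ceiling-upper q rewrite ceiling≡ q =
  subst (ℤ._< ↥ q ℤ.+ ↧ q) (sym c·d≡a+r) (ℤₚ.+-monoʳ-< (↥ q) (ℤ.+<+ (ℤ.n%d<d (ℤ.- ↥ q) (↧ q))))
  where
  f = (ℤ.- ↥ q) ℤ./ ↧ q
  c·d≡a+r : ℤ.- f ℤ.* ↧ q ≡ ↥ q ℤ.+ + ((ℤ.- ↥ q) ℤ.% ↧ q)
  c·d≡a+r = trans (sym (ℤₚ.neg-distribˡ-* f (↧ q)))
                  (neg-swap (↥ q) _ (f ℤ.* ↧ q) (ℤ.a≡a%n+[a/n]*n (ℤ.- ↥ q) (↧ q)))

k/1≡ : ∀ k → + k / 1 ≡ mkℚ (+ k) 0 (coprime-sym (1-coprimeTo k))
k/1≡ k = ℚₚ.normalize-coprime (coprime-sym (1-coprimeTo k))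

module _ (q : ℚ) where

  ceiling-nonNeg : 0ℚ ℚ.≤ q → + 0 ℤ.≤ ceiling q
  ceiling-nonNeg 0≤q = ℤₚ.*-cancelʳ-≤-pos (+ 0) (ceiling q) (↧ q) (ℤₚ.≤-trans 0≤↥q (ceiling-lower q))
    where
    0≤↥q : + 0 ℤ.≤ ↥ q
    0≤↥q = subst (+ 0 ℤ.≤_) (ℤₚ.*-identityʳ (↥ q)) (ℚₚ.drop-*≤* 0≤q)

  ceiling-pos : 0ℚ ℚ.< q → + 0 ℤ.< ceiling q
  ceiling-pos 0<q = ℤₚ.*-cancelʳ-<-nonNeg (↧ q) (ℤₚ.<-≤-trans 0<↥q (ceiling-lower q))
    where
    0<↥q : + 0 ℤ.< ↥ q
    0<↥q = subst (+ 0 ℤ.<_) (ℤₚ.*-identityʳ (↥ q)) (ℚₚ.drop-*<* 0<q)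

  ceiling-<1+ : ∀ k → ↥ q ℤ.≤ + k ℤ.* ↧ q → ceiling q ℤ.< + suc k
  ceiling-<1+ k a≤kd = ℤₚ.*-cancelʳ-<-nonNeg (↧ q) (ℤₚ.<-≤-trans (ceiling-upper q) a+d≤[1+k]d)
    where
    a+d≤[1+k]d : ↥ q ℤ.+ ↧ q ℤ.≤ + suc k ℤ.* ↧ q
    a+d≤[1+k]d = subst (↥ q ℤ.+ ↧ q ℤ.≤_) (sym (ℤₚ.suc-* (+ k) (↧ q)))
                   (ℤₚ.≤-trans (ℤₚ.+-monoˡ-≤ (↧ q) a≤kd) (ℤₚ.≤-reflexive (ℤₚ.+-comm (+ k ℤ.* ↧ q) (↧ q))))

module _ {p : ℚ} where

  thr-≤ : 0ℚ ℚ.≤ p → p ℚ.≤ 1ℚ → ∀ k → thr p k ≤ k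
  thr-≤ 0≤p p≤1 k rewrite k/1≡ k = ∣∣≤ (ceiling-nonNeg x 0≤x) (ceiling-<1+ x k ↥x≤k↧x)
    where
    K = mkℚ (+ k) 0 (coprime-sym (1-coprimeTo k))
    x = p ℚ.* K
    0≤x : 0ℚ ℚ.≤ x
    0≤x = subst (ℚ._≤ x) (ℚₚ.*-zeroˡ K) (ℚₚ.*-monoʳ-≤-nonNeg K 0≤p)
    ↥x≤k↧x : ↥ x ℤ.≤ + k ℤ.* ↧ x
    ↥x≤k↧x = subst (ℤ._≤ + k ℤ.* ↧ x) (ℤₚ.*-identityʳ (↥ x))
               (ℚₚ.drop-*≤* (subst (x ℚ.≤_) (ℚₚ.*-identityˡ K) (ℚₚ.*-monoʳ-≤-nonNeg K p≤1)))
    ∣∣≤ : ∀ {i} → + 0 ℤ.≤ i → i ℤ.< + suc k → ∣ i ∣ ≤ k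
    ∣∣≤ (ℤ.+≤+ _) (ℤ.+<+ (s≤s i≤k)) = i≤k

  thr-pos : 0ℚ ℚ.< p → ∀ {k} → 0 < k → 0 < thr p k
  thr-pos 0<p {suc k} _ rewrite k/1≡ (suc k) = 0<∣∣ (ceiling-pos x 0<x)
    where
    K = mkℚ (+ suc k) 0 (coprime-sym (1-coprimeTo (suc k)))
    x = p ℚ.* K
    0<x : 0ℚ ℚ.< x
    0<x = subst (ℚ._< x) (ℚₚ.*-zeroˡ K) (ℚₚ.*-monoˡ-<-pos K 0<p)
    0<∣∣ : ∀ {i} → + 0 ℤ.< i → 0 < ∣ i ∣
    0<∣∣ (ℤ.+<+ 0<n) = 0<n

∩-monoʳ : ∀ {n} (e : Subset n) {F G} → F ⊆ G → e ∩ F ⊆ e ∩ G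
∩-monoʳ e F⊆G x∈ with Subsetₚ.x∈p∩q⁻ e _ x∈
... | x∈e , x∈F = Subsetₚ.x∈p∩q⁺ (x∈e , F⊆G x∈F)

-- propagate H p is, definitionally, step (thr p) (edges H) for the threshold function t = thr p.
module Propagation {n : ℕ} (t : ℕ → ℕ) where

  Fires : Subset n → Subset n → Set
  Fires F e = t (size e) ≤ size (e ∩ F)

  Fires? : ∀ F e → Dec (Fires F e)
  Fires? F e = t (size e) ≤? size (e ∩ F)

  step : List (Subset n) → Subset n → Subset n
  step es F = foldr (λ e acc → if ⌊ t (size e) ≤? size (e ∩ F) ⌋ then e ∪ acc else acc) F es

  private
    skip-edge : ∀ {F : Subset n} {e es x} → x ∈ F ⊎ (∃ λ f → f ∈ₗ es × Fires F f × x ∈ f) →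
            x ∈ F ⊎ (∃ λ f → f ∈ₗ e ∷ es × Fires F f × x ∈ f)
    skip-edge (inj₁ x∈F)            = inj₁ x∈F
    skip-edge (inj₂ (f , f∈ , rest)) = inj₂ (f , there f∈ , rest)

  ⊆-step : ∀ es F → F ⊆ step es F
  ⊆-step []       F x∈F = x∈F
  ⊆-step (e ∷ es) F x∈F with t (size e) ≤? size (e ∩ F)
  ... | yes _ = Subsetₚ.q⊆p∪q e _ (⊆-step es F x∈F)
  ... | no  _ = ⊆-step es F x∈F

  step⁺ : ∀ es F {e x} → e ∈ₗ es → Fires F e → x ∈ e → x ∈ step es F
  step⁺ (e ∷ es) F (here refl) fires x∈e with t (size e) ≤? size (e ∩ F)
  ... | yes _     = Subsetₚ.p⊆p∪q _ x∈e
  ... | no  quiet = ⊥-elim (quiet fires)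
  step⁺ (e ∷ es) F (there e∈es) fires x∈e with t (size e) ≤? size (e ∩ F)
  ... | yes _ = Subsetₚ.q⊆p∪q e _ (step⁺ es F e∈es fires x∈e)
  ... | no  _ = step⁺ es F e∈es fires x∈e

  step⁻ : ∀ es F {x} → x ∈ step es F → x ∈ F ⊎ ∃ λ e → e ∈ₗ es × Fires F e × x ∈ e
  step⁻ []       F x∈F = inj₁ x∈F
  step⁻ (e ∷ es) F x∈ with t (size e) ≤? size (e ∩ F)
  ... | no  _ = skip-edge (step⁻ es F x∈)
  ... | yes fires with Subsetₚ.x∈p∪q⁻ e _ x∈
  ...   | inj₁ x∈e    = inj₂ (e , here refl , fires , x∈e)
  ...   | inj₂ x∈rest = skip-edge (step⁻ es F x∈rest)

  Fires-mono : ∀ {F G} e → F ⊆ G → Fires F e → Fires G e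
  Fires-mono e F⊆G fires = ℕₚ.≤-trans fires (Subsetₚ.p⊆q⇒∣p∣≤∣q∣ (∩-monoʳ e F⊆G))

  step-mono : ∀ es {F G} → F ⊆ G → step es F ⊆ step es G
  step-mono es {F} {G} F⊆G x∈ with step⁻ es F x∈
  ... | inj₁ x∈F                      = ⊆-step es G (F⊆G x∈F)
  ... | inj₂ (e , e∈es , fires , x∈e) = step⁺ es G e∈es (Fires-mono e F⊆G fires) x∈e

  step-stable : ∀ es F → All (λ e → ¬ Fires F e) es → step es F ≡ F
  step-stable []       F []              = refl
  step-stable (e ∷ es) F (quiet ∷ quiets) with t (size e) ≤? size (e ∩ F)
  ... | yes fires = ⊥-elim (quiet fires)
  ... | no  _     = step-stable es F quiets

∣p∪q∣≤∣p∣+∣q∣ : ∀ {n} (p q : Subset n) → size (p ∪ q) ≤ size p + size q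
∣p∪q∣≤∣p∣+∣q∣ []            []            = z≤n
∣p∪q∣≤∣p∣+∣q∣ (inside ∷ p)  (inside ∷ q)  =
  s≤s (ℕₚ.≤-trans (∣p∪q∣≤∣p∣+∣q∣ p q) (ℕₚ.+-monoʳ-≤ (size p) (ℕₚ.n≤1+n _)))
∣p∪q∣≤∣p∣+∣q∣ (inside ∷ p)  (outside ∷ q) =
  s≤s (∣p∪q∣≤∣p∣+∣q∣ p q)
∣p∪q∣≤∣p∣+∣q∣ (outside ∷ p) (inside ∷ q)  =
  ℕₚ.≤-trans (s≤s (∣p∪q∣≤∣p∣+∣q∣ p q)) (ℕₚ.≤-reflexive (sym (ℕₚ.+-suc (size p) (size q))))
∣p∪q∣≤∣p∣+∣q∣ (outside ∷ p) (outside ∷ q) = ∣p∪q∣≤∣p∣+∣q∣ p q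

⊇Full⇒≡Full : ∀ {n} {F : Subset n} → Full ⊆ F → F ≡ Full
⊇Full⇒≡Full Full⊆F = Subsetₚ.⊆-antisym Subsetₚ.⊆⊤ Full⊆F

∣p∩q∣<∣p∣⇒∃∈∖ : ∀ {n} (p q : Subset n) → size (p ∩ q) < size p → ∃ λ x → x ∈ p × x ∉ q
∣p∩q∣<∣p∣⇒∃∈∖ p q ∣p∩q∣<∣p∣ with Finₚ.any? (λ x → x ∈? p ×-dec ¬? (x ∈? q))
... | yes witness = witness
... | no  none    = ⊥-elim (ℕₚ.<⇒≱ ∣p∩q∣<∣p∣ (Subsetₚ.p⊆q⇒∣p∣≤∣q∣ p⊆p∩q))
  where
  p⊆p∩q : p ⊆ p ∩ q
  p⊆p∩q {x} x∈p with x ∈? q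
  ... | yes x∈q = Subsetₚ.x∈p∩q⁺ (x∈p , x∈q)
  ... | no  x∉q = ⊥-elim (none (x , x∈p , x∉q))

∪-least : ∀ {n} {p q r : Subset n} → p ⊆ r → q ⊆ r → p ∪ q ⊆ r
∪-least {p = p} {q} p⊆r q⊆r x∈ = [ p⊆r , q⊆r ]′ (Subsetₚ.x∈p∪q⁻ p q x∈)

⁅x⁆⊆ : ∀ {n} {x : Fin n} {p} → x ∈ p → ⁅ x ⁆ ⊆ p
⁅x⁆⊆ {x = x} x∈p y∈⁅x⁆ = subst (_∈ _) (sym (Subsetₚ.x∈⁅y⁆⇒x≡y x y∈⁅x⁆)) x∈p

∣p∣≤1+∣p∩q∣ : ∀ {n} (p q : Subset n) v → Full ⊆ q ∪ ⁅ v ⁆ → size p ≤ suc (size (p ∩ q))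
∣p∣≤1+∣p∩q∣ p q v Full⊆q∪v = ℕₚ.≤-trans (Subsetₚ.p⊆q⇒∣p∣≤∣q∣ p⊆v∪p∩q)
  (subst (λ k → size (⁅ v ⁆ ∪ p ∩ q) ≤ k + size (p ∩ q)) (Subsetₚ.∣⁅x⁆∣≡1 v)
    (∣p∪q∣≤∣p∣+∣q∣ ⁅ v ⁆ (p ∩ q)))
  where
  p⊆v∪p∩q : p ⊆ ⁅ v ⁆ ∪ p ∩ q
  p⊆v∪p∩q x∈p with Subsetₚ.x∈p∪q⁻ q ⁅ v ⁆ (Full⊆q∪v Subsetₚ.∈⊤)
  ... | inj₁ x∈q = Subsetₚ.q⊆p∪q ⁅ v ⁆ _ (Subsetₚ.x∈p∩q⁺ (x∈p , x∈q))
  ... | inj₂ x∈⁅v⁆ = Subsetₚ.p⊆p∪q _ x∈⁅v⁆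

sources : ∀ {n} → List (Fin n) → Subset n
sources us = ⋃ (map ⁅_⁆ us)

∈-sources : ∀ {n} (us : List (Fin n)) → All (_∈ sources us) us
∈-sources []       = []
∈-sources (u ∷ us) = Subsetₚ.p⊆p∪q _ (Subsetₚ.x∈⁅x⁆ u) ∷ All.map (Subsetₚ.q⊆p∪q ⁅ u ⁆ _) (∈-sources us)

∣sources∣≤length : ∀ {n} (us : List (Fin n)) → size (sources us) ≤ length us
∣sources∣≤length {n} []       = ℕₚ.≤-reflexive (Subsetₚ.∣⊥∣≡0 n)
∣sources∣≤length     (u ∷ us) = ℕₚ.≤-trans (∣p∪q∣≤∣p∣+∣q∣ ⁅ u ⁆ (sources us))
  (subst (λ k → k + size (sources us) ≤ suc (length us)) (sym (Subsetₚ.∣⁅x⁆∣≡1 u))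
    (s≤s (∣sources∣≤length us)))

sum-map-mono-≤ : ∀ {A : Set} {f g : A → ℕ} → (∀ x → f x ≤ g x) → ∀ xs → sum (map f xs) ≤ sum (map g xs)
sum-map-mono-≤ f≤g []       = z≤n
sum-map-mono-≤ f≤g (x ∷ xs) = ℕₚ.+-mono-≤ (f≤g x) (sum-map-mono-≤ f≤g xs)

sum-map-mono-< : ∀ {A : Set} {f g : A → ℕ} → (∀ x → f x ≤ g x) →
                 ∀ {xs} → Any (λ x → f x < g x) xs → sum (map f xs) < sum (map g xs)
sum-map-mono-< f≤g {x ∷ xs} (here  fx<gx) = ℕₚ.+-mono-<-≤ fx<gx (sum-map-mono-≤ f≤g xs)
sum-map-mono-< f≤g {x ∷ xs} (there below) = ℕₚ.+-mono-≤-< (f≤g x) (sum-map-mono-< f≤g below)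

foldr-⊓-lowerBound : ∀ {A : Set} (f : A → ℕ) a xs →
                     All (λ x → foldr (λ y acc → f y ⊓ acc) (f a) xs ≤ f x) (a ∷ xs)
foldr-⊓-lowerBound f a []       = ℕₚ.≤-refl ∷ []
foldr-⊓-lowerBound f a (x ∷ xs) with foldr-⊓-lowerBound f a xs
... | ≤fa ∷ ≤fxs = ℕₚ.≤-trans (ℕₚ.m⊓n≤n _ _) ≤fa ∷ ℕₚ.m⊓n≤m _ _
                 ∷ All.map (ℕₚ.≤-trans (ℕₚ.m⊓n≤n _ _)) ≤fxs

iterate-fixed : ∀ {A : Set} (f : A → A) {x} → f x ≡ x → ∀ k → iterate f k x ≡ x
iterate-fixed f fx≡x zero    = refl
iterate-fixed f fx≡x (suc k) = trans (cong f (iterate-fixed f fx≡x k)) fx≡x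

flammable⇒thr< : ∀ {p n} {e : Subset n} → 0ℚ ℚ.≤ p → p ℚ.≤ 1ℚ → Flammable p e → thr p (size e) < size e
flammable⇒thr< 0≤p p≤1 flam = ℕₚ.≤∧≢⇒< (thr-≤ 0≤p p≤1 _) flam

module Burning (H : Hypergraph) (p : ℚ) where

  open Propagation {V H} (thr p)

  edge-through : NoIsolated H → ∀ v → ∃ λ e → e ∈ₗ edges H × v ∈ e
  edge-through noIso v =
    find (Any.map (decidable-stable (v ∈? _)) (¬All⇒Any¬ (λ e → ¬? (v ∈? e)) (edges H) (noIso v)))

  all-fire⇒propagate-Full : NoIsolated H → ∀ F → All (Fires F) (edges H) → propagate H p F ≡ Full
  all-fire⇒propagate-Full noIso F all-fire = ⊇Full⇒≡Full λ {v} _ →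
    let (e , e∈E , v∈e) = edge-through noIso v in step⁺ (edges H) F e∈E (All.lookup all-fire e∈E) v∈e

  -- Every edge misses at most the vertex v, and a flammable edge missing one vertex fires.
  almostFull⇒propagate-Full : NoIsolated H → AllFlammable H p → 0ℚ ℚ.≤ p → p ℚ.≤ 1ℚ →
                              ∀ F v → Full ⊆ F ∪ ⁅ v ⁆ → propagate H p F ≡ Full
  almostFull⇒propagate-Full noIso flam 0≤p p≤1 F v almostFull =
    all-fire⇒propagate-Full noIso F (All.map (λ {e} → fires {e}) flam)
    where
    fires : ∀ {e} → Flammable p e → Fires F e
    fires {e} flam-e =
      ℕₚ.≤-pred (ℕₚ.<-≤-trans (flammable⇒thr< {e = e} 0≤p p≤1 flam-e) (∣p∣≤1+∣p∩q∣ e F v almostFull))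

  propagate-∅ : AllFlammable H p → 0ℚ ℚ.< p → p ℚ.≤ 1ℚ → propagate H p ∅ ≡ ∅
  propagate-∅ flam 0<p p≤1 = step-stable (edges H) ∅ (All.map (λ {e} → quiet {e}) flam)
    where
    quiet : ∀ {e} → Flammable p e → ¬ Fires ∅ e
    quiet {e} flam-e fires = ℕₚ.<⇒≱ 0<thr (ℕₚ.≤-trans fires ∣e∩∅∣≤0)
      where
      0<thr : 0 < thr p (size e)
      0<thr = thr-pos 0<p (ℕₚ.≤-<-trans z≤n (flammable⇒thr< {e = e} (ℚₚ.<⇒≤ 0<p) p≤1 flam-e))
      ∣e∩∅∣≤0 : size (e ∩ ∅) ≤ 0
      ∣e∩∅∣≤0 = ℕₚ.≤-trans (Subsetₚ.∣p∩q∣≤∣q∣ e ∅) (ℕₚ.≤-reflexive (Subsetₚ.∣⊥∣≡0 (V H)))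

  -- Round 1 of the game has no propagation; as nothing fires on ∅, it is an ordinary round from ∅.
  first-round : propagate H p ∅ ≡ ∅ → ∀ u → propagate H p ∅ ∪ ⁅ u ⁆ ≡ ⁅ u ⁆
  first-round prop∅ u = trans (cong (_∪ ⁅ u ⁆) prop∅) (Subsetₚ.∪-identityˡ ⁅ u ⁆)

  finalFire≡play-∅ : propagate H p ∅ ≡ ∅ → ∀ s → finalFire H p s ≡ play H p ∅ s
  finalFire≡play-∅ prop∅ []       = refl
  finalFire≡play-∅ prop∅ (u ∷ us) = cong (λ F → play H p F us) (sym (first-round prop∅ u))

  legal-∅⇒Legal : propagate H p ∅ ≡ ∅ → ∀ s → legal H p ∅ s → Legal H p s
  legal-∅⇒Legal prop∅ []       _        = tt
  legal-∅⇒Legal prop∅ (u ∷ us) (_ , ok) = subst (λ F → legal H p F us) (first-round prop∅ u) ok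

  play-∷ʳ : ∀ F us v → play H p F (us ∷ʳ v) ≡ propagate H p (play H p F us) ∪ ⁅ v ⁆
  play-∷ʳ F []       v = refl
  play-∷ʳ F (u ∷ us) v = play-∷ʳ (propagate H p F ∪ ⁅ u ⁆) us v

  ⊆-iterate : ∀ k G → G ⊆ iterate (propagate H p) k G
  ⊆-iterate zero    G x∈G = x∈G
  ⊆-iterate (suc k) G x∈G = ⊆-step (edges H) _ (⊆-iterate k G x∈G)

  -- Each round of the game is matched by one round of propagation from a set containing all sources.
  play-⊆-iterate : ∀ {G} j F us → F ⊆ iterate (propagate H p) j G → All (_∈ G) us →
                   play H p F us ⊆ iterate (propagate H p) (j + length us) G
  play-⊆-iterate {G} j F [] F⊆ [] =
    subst (λ k → F ⊆ iterate (propagate H p) k G) (sym (ℕₚ.+-identityʳ j)) F⊆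
  play-⊆-iterate {G} j F (u ∷ us) F⊆ (u∈G ∷ us⊆G) =
    subst (λ k → play H p F (u ∷ us) ⊆ iterate (propagate H p) k G) (sym (ℕₚ.+-suc j (length us)))
      (play-⊆-iterate (suc j) (propagate H p F ∪ ⁅ u ⁆) us
        (∪-least (step-mono (edges H) F⊆) (⁅x⁆⊆ (⊆-iterate (suc j) G u∈G))) us⊆G)

  -- The sources of all rounds but the last form a lazy burning set: two extra rounds of propagation
  -- make up for the last source, by almostFull⇒propagate-Full.
  burning⇒smaller-lazy : NoIsolated H → AllFlammable H p → 0ℚ ℚ.< p → p ℚ.≤ 1ℚ →
                         ∀ s → IsBurningSequence H p s → ∃ λ S → IsLazyBurningSet H p S × size S < length s
  burning⇒smaller-lazy noIso flam 0<p p≤1 s (_ , burnt) =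
    from-initLast (initLast s) (trans (sym (finalFire≡play-∅ (propagate-∅ flam 0<p p≤1) s)) burnt)
    where
    0≤p = ℚₚ.<⇒≤ 0<p
    from-initLast : ∀ {s} → InitLast s → play H p ∅ s ≡ Full →
                    ∃ λ S → IsLazyBurningSet H p S × size S < length s
    from-initLast []           ()
    from-initLast (us ∷ʳ′ v) burnt = sources us , (suc (suc (length us)) , lazy-burnt) , smaller
      where
      I = iterate (propagate H p) (suc (length us)) (sources us)
      almostFull : Full ⊆ I ∪ ⁅ v ⁆
      almostFull x∈ = ∪-least (λ y∈ → Subsetₚ.p⊆p∪q ⁅ v ⁆ (step-mono (edges H) before-last y∈))
                              (Subsetₚ.q⊆p∪q I ⁅ v ⁆)
                              (subst (_ ∈_) (trans (sym burnt) (play-∷ʳ ∅ us v)) x∈)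
        where
        before-last : play H p ∅ us ⊆ iterate (propagate H p) (length us) (sources us)
        before-last = play-⊆-iterate 0 ∅ us (Subsetₚ.⊆-min _) (∈-sources us)
      lazy-burnt : iterate (propagate H p) (suc (suc (length us))) (sources us) ≡ Full
      lazy-burnt = almostFull⇒propagate-Full noIso flam 0≤p p≤1 I v almostFull
      smaller : size (sources us) < length (us ∷ʳ v)
      smaller = subst (size (sources us) <_) (sym (length-++ us))
                  (ℕₚ.<-≤-trans (s≤s (∣sources∣≤length us)) (ℕₚ.≤-reflexive (ℕₚ.+-comm 1 (length us))))

  Fires-Full : 0ℚ ℚ.≤ p → p ℚ.≤ 1ℚ → ∀ e → Fires Full e
  Fires-Full 0≤p p≤1 e =
    subst (thr p (size e) ≤_) (sym (cong size (Subsetₚ.∩-identityʳ e))) (thr-≤ 0≤p p≤1 (size e))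

  below-thresholds⇒quiet : ∀ {t S} → All (λ e → t ≤ thr p (size e)) (edges H) → size S < t →
                           All (λ e → ¬ Fires S e) (edges H)
  below-thresholds⇒quiet {S = S} t≤thr ∣S∣<t = All.map
    (λ {e} t≤thr-e fires → ℕₚ.<⇒≱ ∣S∣<t (ℕₚ.≤-trans t≤thr-e (ℕₚ.≤-trans fires (Subsetₚ.∣p∩q∣≤∣q∣ e S))))
    t≤thr

  lazy-≥-thresholdBound : NoIsolated H → 0ℚ ℚ.≤ p → p ℚ.≤ 1ℚ → ∀ {t S} →
                          All (λ e → t ≤ thr p (size e)) (edges H) → IsLazyBurningSet H p S → t ≤ size S
  lazy-≥-thresholdBound noIso 0≤p p≤1 {t} {S} t≤thr (k , burnt) = ℕₚ.≮⇒≥ λ ∣S∣<t →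
    let quiet          = below-thresholds⇒quiet t≤thr ∣S∣<t
        S≡Full         = trans (sym (iterate-fixed (propagate H p) (step-stable (edges H) S quiet) k)) burnt
        (e , e∈E , _) = edge-through noIso zero
    in  All.lookup quiet e∈E (subst (λ F → Fires F e) (sym S≡Full) (Fires-Full 0≤p p≤1 e))

  deficit : Subset (V H) → Subset (V H) → ℕ
  deficit F e = thr p (size e) ∸ size (e ∩ F)

  Deficit : Subset (V H) → ℕ
  Deficit F = sum (map (deficit F) (edges H))

  Deficit≤sumThr : ∀ F → Deficit F ≤ sumThr H p
  Deficit≤sumThr F = sum-map-mono-≤ (λ e → ℕₚ.m∸n≤m (thr p (size e)) (size (e ∩ F))) (edges H)

  deficit-anti : ∀ {F G} → F ⊆ G → ∀ e → deficit G e ≤ deficit F e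
  deficit-anti F⊆G e = ℕₚ.∸-monoʳ-≤ (thr p (size e)) (Subsetₚ.p⊆q⇒∣p∣≤∣q∣ (∩-monoʳ e F⊆G))

  deficit-< : ∀ {F G u e} → F ⊆ G → u ∈ e → u ∉ F → u ∈ G → ¬ Fires F e → deficit G e < deficit F e
  deficit-< {F} {G} {u} {e} F⊆G u∈e u∉F u∈G quiet =
    ℕₚ.≤-<-trans (ℕₚ.∸-monoʳ-≤ (thr p (size e)) ∣e∩F∣<∣e∩G∣) (ℕₚ.∸-monoʳ-< (ℕₚ.n<1+n _) (ℕₚ.≰⇒> quiet))
    where
    ∣e∩F∣<∣e∩G∣ : size (e ∩ F) < size (e ∩ G)
    ∣e∩F∣<∣e∩G∣ = Subsetₚ.p⊂q⇒∣p∣<∣q∣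
      (∩-monoʳ e F⊆G , u , Subsetₚ.x∈p∩q⁺ (u∈e , u∈G) ,
       λ u∈e∩F → u∉F (proj₂ (Subsetₚ.x∈p∩q⁻ e F u∈e∩F)))

  ⊆-next : ∀ F u → F ⊆ propagate H p F ∪ ⁅ u ⁆
  ⊆-next F u x∈F = Subsetₚ.p⊆p∪q ⁅ u ⁆ (⊆-step (edges H) F x∈F)

  ∈-next : ∀ F u → u ∈ propagate H p F ∪ ⁅ u ⁆
  ∈-next F u = Subsetₚ.q⊆p∪q (propagate H p F) ⁅ u ⁆ (Subsetₚ.x∈⁅x⁆ u)

  quiet-edge⇒progress : 0ℚ ℚ.≤ p → p ℚ.≤ 1ℚ → ∀ F {e} → e ∈ₗ edges H → ¬ Fires F e →
                        ∃ λ u → u ∉ F × Deficit (propagate H p F ∪ ⁅ u ⁆) < Deficit F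
  quiet-edge⇒progress 0≤p p≤1 F {e} e∈E quiet =
    let (u , u∈e , u∉F) = ∣p∩q∣<∣p∣⇒∃∈∖ e F (ℕₚ.<-≤-trans (ℕₚ.≰⇒> quiet) (thr-≤ 0≤p p≤1 (size e)))
    in  u , u∉F , sum-map-mono-< (deficit-anti (⊆-next F u))
                    (lose e∈E (deficit-< (⊆-next F u) u∈e u∉F (∈-next F u) quiet))

  Finishable : Subset (V H) → ℕ → Set
  Finishable F k = Σ (List (Fin (V H))) λ us → legal H p F us × play H p F us ≡ Full × length us ≤ k

  greedy : NoIsolated H → 0ℚ ℚ.≤ p → p ℚ.≤ 1ℚ → ∀ n F → Deficit F ≤ n → Finishable F (suc n)
  greedy noIso 0≤p p≤1 n F D≤n = by-cases (Finₚ.any? (λ u → ¬? (u ∈? F))) (All.all? (Fires? F) (edges H))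
    where
    descend : ∀ n → Deficit F ≤ n → (∃ λ w → w ∉ F × Deficit (propagate H p F ∪ ⁅ w ⁆) < Deficit F) →
              Finishable F (suc n)
    descend zero    D≤0 (w , w∉F , D′<D) = ⊥-elim (ℕₚ.n≮0 (ℕₚ.<-≤-trans D′<D D≤0))
    descend (suc n) D≤n (w , w∉F , D′<D) =
      let (us , ok , burnt , length≤) = greedy noIso 0≤p p≤1 n _ (ℕₚ.≤-pred (ℕₚ.<-≤-trans D′<D D≤n))
      in  w ∷ us , (w∉F , ok) , burnt , s≤s length≤

    by-cases : Dec (∃ λ u → u ∉ F) → Dec (All (Fires F) (edges H)) → Finishable F (suc n)
    by-cases (no none-unburnt) _ =
      [] , tt , ⊇Full⇒≡Full (λ {u} _ → decidable-stable (u ∈? F) (λ u∉F → none-unburnt (u , u∉F))) , z≤n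
    by-cases (yes (u , u∉F)) (yes all-fire) =
      u ∷ [] , (u∉F , tt) , ⊇Full⇒≡Full (λ _ → Subsetₚ.p⊆p∪q ⁅ u ⁆ all-burnt) , s≤s z≤n
      where
      all-burnt : ∀ {x} → x ∈ propagate H p F
      all-burnt {x} = subst (x ∈_) (sym (all-fire⇒propagate-Full noIso F all-fire)) Subsetₚ.∈⊤
    by-cases (yes _) (no some-quiet) =
      let (e , e∈E , quiet) = find (¬All⇒Any¬ (Fires? F) (edges H) some-quiet)
      in  descend n D≤n (quiet-edge⇒progress 0≤p p≤1 F e∈E quiet)

  greedy-burning : NoIsolated H → AllFlammable H p → 0ℚ ℚ.< p → p ℚ.≤ 1ℚ →
                   ∃ λ s → IsBurningSequence H p s × length s ≤ 1 + sumThr H p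
  greedy-burning noIso flam 0<p p≤1 =
    let (s , ok , burnt , length≤) = greedy noIso (ℚₚ.<⇒≤ 0<p) p≤1 (sumThr H p) ∅ (Deficit≤sumThr ∅)
    in  s , (legal-∅⇒Legal prop∅ s ok , trans (finalFire≡play-∅ prop∅ s) burnt) , length≤
    where
    prop∅ = propagate-∅ flam 0<p p≤1

minThr≤thr : ∀ H p → All (λ e → minThr H p ≤ thr p (size e)) (edges H)
minThr≤thr (hypergraph m [])       p = []
minThr≤thr (hypergraph m (e ∷ es)) p = foldr-⊓-lowerBound (λ e → thr p (size e)) e es

theorem2p20 : (H : Hypergraph) (p : ℚ) → 0ℚ <ℚ p → p <ℚ 1ℚ →
    NoIsolated H → AllFlammable H p →
    (b bL : ℕ) → IsBurningNumber H p b → IsLazyBurningNumber H p bL →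
    (minThr H p ≤ bL) × (bL < b) × (b ≤ 1 + sumThr H p)
theorem2p20 H p 0<p p<1 noIso flam b bL ((s , s-burning , refl) , b-minimal) ((S , S-lazy , refl) , bL-minimal) =
  lazy-≥-thresholdBound noIso 0≤p p≤1 (minThr≤thr H p) S-lazy , bL<b , b≤1+sumThr
  where
  open Burning H p
  0≤p = ℚₚ.<⇒≤ 0<p
  p≤1 = ℚₚ.<⇒≤ p<1

  bL<b : size S < length s
  bL<b = let (S′ , S′-lazy , ∣S′∣<∣s∣) = burning⇒smaller-lazy noIso flam 0<p p≤1 s s-burning
         in  ℕₚ.≤-<-trans (bL-minimal S′ S′-lazy) ∣S′∣<∣s∣

  b≤1+sumThr : length s ≤ 1 + sumThr H p
  b≤1+sumThr = let (s′ , s′-burning , ∣s′∣≤) = greedy-burning noIso flam 0<p p≤1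
               in  ℕₚ.≤-trans (b-minimal s′ s′-burning) ∣s′∣≤
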